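{- The only solutions of the Diophantine equation $F_n - F_m = 13^a$ in non-negative integers $(n,m,a)$ with $n \geqslant 2$ and $m < n$ are $$(n,m,a) \in \{(2,0,0),(3,1,0),(3,2,0),(4,3,0),(7,0,1),(8,6,1),(9,8,1)\},$$ namely $F_2 - F_0 = F_3 - F_1 = F_3 - F_2 = F_4 - F_3 = 13^0$ and $F_7 - F_0 = F_8 - F_6 = F_9 - F_8 = 13^1$.
   Context: $(F_n)_{n\geqslant 0}$ denotes the Fibonacci sequence: $F_0=0$, $F_1=1$, and $F_n=F_{n-1}+F_{n-2}$ for $n\geqslant 2$. -}

module Defs where

open import Data.Nat using (ℕ; zero; suc; _+_)

F : ℕ → ℕ
F zero = 0
F (suc zero) = 1
F (suc (suc n)) = F (suc n) + F n

{-# OPTIONS --safe #-}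
-- For a ≥ 2 the power 13^a vanishes modulo 169, so F n ≡ F m (mod 169); as 364 is the
-- period of F modulo 169, this leaves 1248 pairs (n mod 364, m mod 364).  For each of them,
-- the equation modulo 29, 233 and 521 (whose Fibonacci periods divide 364) restricts a modulo
-- 14, 116 and 260, the orders of 13, and no choice of these residues is consistent; the ten
-- pairs that survive are refuted in the same way modulo 1092, adding the primes 79 and 211.
-- For a ≤ 1 the growth of F forces n ≤ 9, and a finite check remains.
module Submission where

open import Defs
open import Data.Nat using (ℕ; _+_; _^_; _≤_; _<_)
open import Data.Product using (_×_; _,_)
open import Data.List using (_∷_; [])
open import Data.List.Membership.Propositional using (_∈_)
open import Relation.Binary.PropositionalEquality using (_≡_)
open import Function.Bundles using (_⇔_)

open import Data.Bool using (Bool; true; false; T; not; _∧_; _∨_)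
open import Data.Bool.Properties using (T-∧; T-∨; T-≡)
open import Data.Bool.ListAction using (all)
open import Data.Empty using (⊥; ⊥-elim)
open import Data.List using (List; upTo)
open import Data.List.Membership.Propositional.Properties using (∈-upTo⁺)
open import Data.List.Relation.Unary.All as All using (All; []; _∷_)
open import Data.List.Relation.Unary.All.Properties using (all⁻; all⁺)
open import Data.Nat using (zero; suc; _*_; _%_; _/_; _≡ᵇ_; NonZero; ≢-nonZero; ≢-nonZero⁻¹; z≤n; s≤s; z<s; s<s; _≤?_; _≟_)
open import Data.Nat.DivMod
open import Data.Nat.Divisibility using (_∣_; divides; m∣m*n)
open import Data.Nat.GCD using (gcd; gcd[m,n]≢0; gcd[m,n]∣m; gcd[m,n]∣n)
open import Data.Nat.GeneralisedArithmetic using (iterate)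
open import Data.Nat.Properties
open import Data.Product using (proj₁; proj₂)
open import Data.Product.Properties using (≡-dec)
open import Data.Sum using (inj₁; inj₂; [_,_]′)
open import Function using (_∘_)
open import Function.Bundles using (mk⇔; Equivalence)
open import Relation.Binary.PropositionalEquality using (refl; sym; trans; cong; cong₂; subst; subst₂; module ≡-Reasoning)
open import Relation.Nullary using (¬_; Dec)
open import Relation.Nullary.Decidable using (_→-dec_; isYes; toWitness)
import Data.List.Membership.DecPropositional as DecMembership

open Equivalence using (to; from)

T-not⇒¬T : ∀ {b} → T (not b) → ¬ T b
T-not⇒¬T {false} _ ()

all-upTo-sound : ∀ (p : ℕ → Bool) n {k} → T (all p (upTo n)) → k < n → T (p k)
all-upTo-sound p n h k<n = All.lookup (all⁺ p (upTo n) h) (∈-upTo⁺ k<n)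

module _ {A : Set} (f : A → A) where

  iterate-+ : ∀ x m n → iterate f x (m + n) ≡ iterate f (iterate f x m) n
  iterate-+ x zero n = refl
  iterate-+ x (suc m) n = iterate-+ (f x) m n

  iterate-periodic : ∀ {x L} → iterate f x L ≡ x → ∀ r q → iterate f x (r + q * L) ≡ iterate f x r
  iterate-periodic p r zero = cong (iterate f _) (+-identityʳ r)
  iterate-periodic {x} {L} p r (suc q) = begin
    iterate f x (r + (L + q * L))           ≡⟨ cong (iterate f x) (+-comm r (L + q * L)) ⟩
    iterate f x ((L + q * L) + r)           ≡⟨ cong (iterate f x) (+-assoc L (q * L) r) ⟩
    iterate f x (L + (q * L + r))           ≡⟨ iterate-+ x L (q * L + r) ⟩
    iterate f (iterate f x L) (q * L + r)   ≡⟨ cong (λ y → iterate f y (q * L + r)) p ⟩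
    iterate f x (q * L + r)                 ≡⟨ cong (iterate f x) (+-comm (q * L) r) ⟩
    iterate f x (r + q * L)                 ≡⟨ iterate-periodic p r q ⟩
    iterate f x r                           ∎
    where open ≡-Reasoning

  iterate-% : ∀ {x L} .{{_ : NonZero L}} → iterate f x L ≡ x → ∀ n → iterate f x (n % L) ≡ iterate f x n
  iterate-% {x} {L} p n = trans (sym (iterate-periodic p (n % L) (n / L))) (cong (iterate f x) (sym (m≡m%n+[m/n]*n n L)))

  allOnOrbit : ℕ → A → (ℕ → A → Bool) → Bool
  allOnOrbit zero x P = true
  allOnOrbit (suc n) x P = P 0 x ∧ allOnOrbit n (f x) (P ∘ suc)

  anyOnOrbit : ℕ → A → (ℕ → A → Bool) → Bool
  anyOnOrbit zero x P = false
  anyOnOrbit (suc n) x P = P 0 x ∨ anyOnOrbit n (f x) (P ∘ suc)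

  allOnOrbit-sound : ∀ {n x P k} → T (allOnOrbit n x P) → k < n → T (P k (iterate f x k))
  allOnOrbit-sound {suc n} {x} {P} {zero} h _ = proj₁ (to (T-∧ {P 0 x}) h)
  allOnOrbit-sound {suc n} {x} {P} {suc k} h (s<s k<n) = allOnOrbit-sound (proj₂ (to (T-∧ {P 0 x}) h)) k<n

  anyOnOrbit-complete : ∀ {n x P k} → k < n → T (P k (iterate f x k)) → T (anyOnOrbit n x P)
  anyOnOrbit-complete {suc n} {x} {P} {zero} _ h = from (T-∨ {P 0 x}) (inj₁ h)
  anyOnOrbit-complete {suc n} {x} {P} {suc k} (s<s k<n) h = from (T-∨ {P 0 x}) (inj₂ (anyOnOrbit-complete k<n h))

module _ (M : ℕ) .{{_ : NonZero M}} where

  fibStep : ℕ × ℕ → ℕ × ℕ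
  fibStep (a , b) = b , (a + b) % M

  fibResidues : ℕ → ℕ × ℕ
  fibResidues = iterate fibStep (0 % M , 1 % M)

  iterate-fibStep : ∀ k c → iterate fibStep (F k % M , F (suc k) % M) c ≡ (F (k + c) % M , F (suc (k + c)) % M)
  iterate-fibStep k zero = cong (λ t → F t % M , F (suc t) % M) (sym (+-identityʳ k))
  iterate-fibStep k (suc c) = begin
    iterate fibStep (F (suc k) % M , (F k % M + F (suc k) % M) % M) c
      ≡⟨ cong (λ r → iterate fibStep (F (suc k) % M , r) c) next-residue ⟩
    iterate fibStep (F (suc k) % M , F (suc (suc k)) % M) c
      ≡⟨ iterate-fibStep (suc k) c ⟩
    (F (suc k + c) % M , F (suc (suc k + c)) % M)
      ≡⟨ cong (λ t → F t % M , F (suc t) % M) (sym (+-suc k c)) ⟩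
    (F (k + suc c) % M , F (suc (k + suc c)) % M) ∎
    where
    open ≡-Reasoning
    next-residue : (F k % M + F (suc k) % M) % M ≡ F (suc (suc k)) % M
    next-residue = trans (sym (%-distribˡ-+ (F k) (F (suc k)) M)) (cong (_% M) (+-comm (F k) (F (suc k))))

  fibResidues-correct : ∀ n → fibResidues n ≡ (F n % M , F (suc n) % M)
  fibResidues-correct = iterate-fibStep 0

  F-%-periodic : ∀ {L} .{{_ : NonZero L}} → fibResidues L ≡ fibResidues 0 → ∀ n → F (n % L) % M ≡ F n % M
  F-%-periodic {L} period n = begin
    F (n % L) % M                 ≡⟨ cong proj₁ (sym (fibResidues-correct (n % L))) ⟩
    proj₁ (fibResidues (n % L))   ≡⟨ cong proj₁ (iterate-% fibStep period n) ⟩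
    proj₁ (fibResidues n)         ≡⟨ cong proj₁ (fibResidues-correct n) ⟩
    F n % M                       ∎
    where open ≡-Reasoning

  powStep : ℕ → ℕ → ℕ
  powStep x y = x * y % M

  iterate-powStep : ∀ x k c → iterate (powStep x) (x ^ k % M) c ≡ x ^ (k + c) % M
  iterate-powStep x k zero = cong (λ t → x ^ t % M) (sym (+-identityʳ k))
  iterate-powStep x k (suc c) = begin
    iterate (powStep x) (x * (x ^ k % M) % M) c   ≡⟨ cong (λ y → iterate (powStep x) y c) next-residue ⟩
    iterate (powStep x) (x ^ suc k % M) c         ≡⟨ iterate-powStep x (suc k) c ⟩
    x ^ (suc k + c) % M                           ≡⟨ cong (λ t → x ^ t % M) (sym (+-suc k c)) ⟩
    x ^ (k + suc c) % M                           ∎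
    where
    open ≡-Reasoning
    next-residue : x * (x ^ k % M) % M ≡ x ^ suc k % M
    next-residue = begin
      x * (x ^ k % M) % M             ≡⟨ %-distribˡ-* x (x ^ k % M) M ⟩
      x % M * (x ^ k % M % M) % M     ≡⟨ cong (λ t → x % M * t % M) (m%n%n≡m%n (x ^ k) M) ⟩
      x % M * (x ^ k % M) % M         ≡⟨ sym (%-distribˡ-* x (x ^ k) M) ⟩
      x ^ suc k % M                   ∎

  ^-%-periodic : ∀ {x k o} .{{_ : NonZero o}} → iterate (powStep x) (x ^ k % M) o ≡ x ^ k % M →
                 ∀ b → x ^ (k + b % o) % M ≡ x ^ (k + b) % M
  ^-%-periodic {x} {k} {o} period b = begin
    x ^ (k + b % o) % M                          ≡⟨ sym (iterate-powStep x k (b % o)) ⟩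
    iterate (powStep x) (x ^ k % M) (b % o)      ≡⟨ iterate-% (powStep x) period b ⟩
    iterate (powStep x) (x ^ k % M) b            ≡⟨ iterate-powStep x k b ⟩
    x ^ (k + b) % M                              ∎
    where open ≡-Reasoning

-- Both periods are stated on orbits of residues, so that they can be checked by evaluation.
record PeriodicModulus (L : ℕ) : Set where
  constructor periodic
  field
    modulus order : ℕ
    {{modulus≢0}} : NonZero modulus
    {{order≢0}} : NonZero order
    fib-period : fibResidues modulus L ≡ fibResidues modulus 0
    pow-period : iterate (powStep modulus 13) (13 ^ 2 % modulus) order ≡ 13 ^ 2 % modulus

open PeriodicModulus

module _ {L : ℕ} .{{_ : NonZero L}} where

  ResidueEquation : PeriodicModulus L → ℕ → ℕ → ℕ → Set
  ResidueEquation p b i j = F i % modulus p ≡ (F j + 13 ^ (2 + b % order p)) % modulus p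

  residueEquation : ∀ {n m b} (p : PeriodicModulus L) → F n ≡ F m + 13 ^ (2 + b) → ResidueEquation p b (n % L) (m % L)
  residueEquation {n} {m} {b} p eq = begin
    F (n % L) % M                                    ≡⟨ F-%-periodic M (fib-period p) n ⟩
    F n % M                                          ≡⟨ cong (_% M) eq ⟩
    (F m + 13 ^ (2 + b)) % M                         ≡⟨ %-distribˡ-+ (F m) (13 ^ (2 + b)) M ⟩
    (F m % M + 13 ^ (2 + b) % M) % M                 ≡⟨ cong₂ (λ u v → (u + v) % M) (sym (F-%-periodic M (fib-period p) m))
                                                                                     (sym (^-%-periodic M {13} {2} (pow-period p) b)) ⟩
    (F (m % L) % M + 13 ^ (2 + b % o) % M) % M       ≡⟨ sym (%-distribˡ-+ (F (m % L)) (13 ^ (2 + b % o)) M) ⟩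
    (F (m % L) + 13 ^ (2 + b % o)) % M               ∎
    where
    open ≡-Reasoning
    M o : ℕ
    M = modulus p
    o = order p

gcd≢0ˡ : ∀ {m n} .{{_ : NonZero m}} → NonZero (gcd m n)
gcd≢0ˡ {m} {n} = ≢-nonZero (gcd[m,n]≢0 m n (inj₁ (≢-nonZero⁻¹ m)))

-- By the Chinese remainder theorem, c and r are residues of one number modulo o and o′
-- exactly when they agree modulo gcd o o′.
compatibleᵇ : ∀ o o′ .{{_ : NonZero o}} → ℕ → ℕ → Bool
compatibleᵇ o o′ c r = c % gcd o o′ ≡ᵇ r % gcd o o′
  where
  instance
    gcd≢0 : NonZero (gcd o o′)
    gcd≢0 = gcd≢0ˡ {o} {o′}

compatibleᵇ-% : ∀ o o′ .{{_ : NonZero o}} .{{_ : NonZero o′}} b → T (compatibleᵇ o o′ (b % o) (b % o′))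
compatibleᵇ-% o o′ b = ≡⇒≡ᵇ _ _ (trans (m∣n⇒o%n%m≡o%m g o b (gcd[m,n]∣m o o′)) (sym (m∣n⇒o%n%m≡o%m g o′ b (gcd[m,n]∣n o o′))))
  where
  g : ℕ
  g = gcd o o′
  instance
    g≢0 : NonZero g
    g≢0 = gcd≢0ˡ {o} {o′}

Choice : ℕ → Set
Choice L = ℕ × PeriodicModulus L

-- It is opaque so that
-- unification never unfolds the search on symbolic arguments.
opaque
  solvable : ∀ {L} → ℕ → ℕ → List (Choice L) → List (PeriodicModulus L) → Bool
  solvable i j chosen [] = true
  solvable i j chosen (p ∷ ps) = extend (proj₁ (fibResidues M i)) (proj₁ (fibResidues M j))
    where
    M : ℕ
    M = modulus p
    extend : ℕ → ℕ → Bool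
    extend fi fj = anyOnOrbit (powStep M 13) (order p) (13 ^ 2 % M) λ c r →
      (fi ≡ᵇ (fj + r) % M) ∧ all (λ (r′ , q) → compatibleᵇ (order p) (order q) c r′) chosen ∧ solvable i j ((c , p) ∷ chosen) ps

  solvable-complete : ∀ {L} .{{_ : NonZero L}} {i j b} (chosen : List (Choice L)) ps →
                      All (λ (r , q) → r ≡ b % order q) chosen → All (λ p → ResidueEquation p b i j) ps →
                      T (solvable i j chosen ps)
  solvable-complete chosen [] _ _ = _
  solvable-complete {i = i} {j} {b} chosen (p ∷ ps) chosen-ok (eq ∷ eqs) =
    anyOnOrbit-complete (powStep M 13) (m%n<n b o)
      (from T-∧ (residue-ok , from T-∧ (compatible-ok , solvable-complete {i = i} {j} {b} ((b % o , p) ∷ chosen) ps (refl ∷ chosen-ok) eqs)))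
    where
    M o : ℕ
    M = modulus p
    o = order p
    residue-ok : T (proj₁ (fibResidues M i) ≡ᵇ (proj₁ (fibResidues M j) + iterate (powStep M 13) (13 ^ 2 % M) (b % o)) % M)
    residue-ok = ≡⇒≡ᵇ _ _ (begin
      proj₁ (fibResidues M i)                                ≡⟨ cong proj₁ (fibResidues-correct M i) ⟩
      F i % M                                                ≡⟨ eq ⟩
      (F j + 13 ^ (2 + b % o)) % M                           ≡⟨ %-distribˡ-+ (F j) (13 ^ (2 + b % o)) M ⟩
      (F j % M + 13 ^ (2 + b % o) % M) % M                   ≡⟨ cong₂ (λ u v → (u + v) % M)
                                                                      (cong proj₁ (sym (fibResidues-correct M j)))
                                                                      (sym (iterate-powStep M 13 2 (b % o))) ⟩
      (proj₁ (fibResidues M j) + iterate (powStep M 13) (13 ^ 2 % M) (b % o)) % M ∎)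
      where open ≡-Reasoning
    compatible-ok : T (all (λ (r′ , q) → compatibleᵇ o (order q) (b % o) r′) chosen)
    compatible-ok = all⁻ _ (All.map (λ { {_ , q} refl → compatibleᵇ-% o (order q) b }) chosen-ok)

stage₁ : List (PeriodicModulus 364)
stage₁ = periodic 29 14 refl refl ∷ periodic 233 116 refl refl ∷ periodic 521 260 refl refl ∷ []

stage₂ : List (PeriodicModulus 1092)
stage₂ = periodic 29 14 refl refl ∷ periodic 233 116 refl refl ∷ periodic 521 260 refl refl
       ∷ periodic 79 39 refl refl ∷ periodic 211 35 refl refl ∷ []

refutedBy : ∀ {L} → List (PeriodicModulus L) → ℕ → ℕ → Bool
refutedBy ps i j = not (solvable i j [] ps)

liftsRefuted : ℕ → ℕ → Bool
liftsRefuted i j = all (λ k → all (λ l → refutedBy stage₂ (i + k * 364) (j + l * 364)) (upTo 3)) (upTo 3)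

excluded : ℕ → ℕ → Bool
excluded i j = refutedBy stage₁ i j ∨ liftsRefuted i j

excludedPair : ℕ → ℕ × ℕ → ℕ → ℕ × ℕ → Bool
excludedPair i s j t = not (proj₁ s ≡ᵇ proj₁ t) ∨ excluded i j

excludedRow : ℕ → ℕ × ℕ → Bool
excludedRow i s = allOnOrbit (fibStep 169) 364 (fibResidues 169 0) (excludedPair i s)

opaque
  unfolding solvable
  certificate : allOnOrbit (fibStep 169) 364 (fibResidues 169 0) excludedRow ≡ true
  certificate = refl

lift-% : ∀ n → n % 1092 ≡ n % 364 + n % 1092 / 364 * 364
lift-% n = trans (m≡m%n+[m/n]*n (n % 1092) 364) (cong (_+ n % 1092 / 364 * 364) (m∣n⇒o%n%m≡o%m 364 1092 n (divides 3 refl)))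

lift-quotient<3 : ∀ n → n % 1092 / 364 < 3
lift-quotient<3 n = m<n*o⇒m/o<n (m%n<n n 1092)

module _ {n m b : ℕ} (eq : F n ≡ F m + 13 ^ (2 + b)) where

  ¬refutedBy : ∀ {L} .{{_ : NonZero L}} (ps : List (PeriodicModulus L)) → ¬ T (refutedBy ps (n % L) (m % L))
  ¬refutedBy ps refuted = T-not⇒¬T refuted (solvable-complete {b = b} [] ps [] (All.universal (λ p → residueEquation p eq) ps))

  ¬liftsRefuted : ¬ T (liftsRefuted (n % 364) (m % 364))
  ¬liftsRefuted refuted = ¬refutedBy stage₂ (subst₂ (λ i j → T (refutedBy stage₂ i j)) (sym (lift-% n)) (sym (lift-% m)) lifted)
    where
    i j k l : ℕ
    i = n % 364
    j = m % 364
    k = n % 1092 / 364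
    l = m % 1092 / 364
    lifted : T (refutedBy stage₂ (i + k * 364) (j + l * 364))
    lifted = all-upTo-sound (λ l → refutedBy stage₂ (i + k * 364) (j + l * 364)) 3
               (all-upTo-sound (λ k → all (λ l → refutedBy stage₂ (i + k * 364) (j + l * 364)) (upTo 3)) 3
                 refuted (lift-quotient<3 n))
               (lift-quotient<3 m)

  ¬excluded : ¬ T (excluded (n % 364) (m % 364))
  ¬excluded = [ ¬refutedBy stage₁ , ¬liftsRefuted ]′ ∘ to (T-∨ {refutedBy stage₁ (n % 364) (m % 364)})

  fibResidue-169-agree : proj₁ (fibResidues 169 (n % 364)) ≡ proj₁ (fibResidues 169 (m % 364))
  fibResidue-169-agree = begin
    proj₁ (fibResidues 169 (n % 364))   ≡⟨ cong proj₁ (iterate-% (fibStep 169) refl n) ⟩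
    proj₁ (fibResidues 169 n)           ≡⟨ cong proj₁ (fibResidues-correct 169 n) ⟩
    F n % 169                           ≡⟨ cong (_% 169) eq ⟩
    (F m + 13 ^ (2 + b)) % 169          ≡⟨ %-remove-+ʳ (F m) 169∣13^[2+b] ⟩
    F m % 169                           ≡⟨ cong proj₁ (sym (fibResidues-correct 169 m)) ⟩
    proj₁ (fibResidues 169 m)           ≡⟨ cong proj₁ (sym (iterate-% (fibStep 169) refl m)) ⟩
    proj₁ (fibResidues 169 (m % 364))   ∎
    where
    open ≡-Reasoning
    169∣13^[2+b] : 169 ∣ 13 ^ (2 + b)
    169∣13^[2+b] = subst (169 ∣_) (*-assoc 13 13 (13 ^ b)) (m∣m*n (13 ^ b))

  exponent≥2-impossible : ⊥
  exponent≥2-impossible = [ residues-agree , ¬excluded ]′ (to (T-∨ {not (proj₁ sₙ ≡ᵇ proj₁ sₘ)}) pair-excluded)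
    where
    sₙ sₘ : ℕ × ℕ
    sₙ = fibResidues 169 (n % 364)
    sₘ = fibResidues 169 (m % 364)
    row-excluded : T (excludedRow (n % 364) sₙ)
    row-excluded = allOnOrbit-sound (fibStep 169) {364} {fibResidues 169 0} {excludedRow} (from T-≡ certificate) (m%n<n n 364)
    pair-excluded : T (excludedPair (n % 364) sₙ (m % 364) sₘ)
    pair-excluded = allOnOrbit-sound (fibStep 169) {364} {fibResidues 169 0} {excludedPair (n % 364) sₙ} row-excluded (m%n<n m 364)
    residues-agree : ¬ T (not (proj₁ sₙ ≡ᵇ proj₁ sₘ))
    residues-agree differ = T-not⇒¬T differ (≡⇒≡ᵇ _ _ fibResidue-169-agree)

solutions : List (ℕ × ℕ × ℕ)
solutions = (2 , 0 , 0) ∷ (3 , 1 , 0) ∷ (3 , 2 , 0) ∷ (4 , 3 , 0) ∷ (7 , 0 , 1) ∷ (8 , 6 , 1) ∷ (9 , 8 , 1) ∷ []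

solutions-correct : All (λ (n , m , a) → F n ≡ F m + 13 ^ a) solutions
solutions-correct = refl ∷ refl ∷ refl ∷ refl ∷ refl ∷ refl ∷ refl ∷ []

F≤F-suc : ∀ n → F n ≤ F (suc n)
F≤F-suc zero = z≤n
F≤F-suc (suc n) = m≤m+n (F (suc n)) (F n)

F-mono : ∀ {m n} → m ≤ n → F m ≤ F n
F-mono {n = zero} z≤n = ≤-refl
F-mono {n = suc n} m≤1+n with m≤n⇒m<n∨m≡n m≤1+n
... | inj₁ (s≤s m≤n) = ≤-trans (F-mono m≤n) (F≤F-suc n)
... | inj₂ refl = ≤-refl

exponent<2⇒n<10 : ∀ {n m a} → 2 ≤ n → m < n → a < 2 → F n ≡ F m + 13 ^ a → n < 10
exponent<2⇒n<10 {suc (suc k)} {m} {a} (s≤s (s≤s _)) (s≤s m≤1+k) (s≤s a≤1) eq = s<s (s<s k<8)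
  where
  Fk≤13 : F k ≤ 13
  Fk≤13 = ≤-trans (+-cancelˡ-≤ (F m) (F k) (13 ^ a)
                     (≤-trans (+-monoˡ-≤ (F k) (F-mono m≤1+k)) (≤-reflexive eq)))
                  (^-monoʳ-≤ 13 a≤1)
  k<8 : k < 8
  k<8 = ≰⇒> (λ 8≤k → <⇒≱ (m≤m+n 14 7) (≤-trans (F-mono 8≤k) Fk≤13))

open DecMembership (≡-dec _≟_ (≡-dec _≟_ _≟_)) using (_∈?_)

small-solution? : ∀ n m a → Dec (2 ≤ n → F n ≡ F m + 13 ^ a → (n , m , a) ∈ solutions)
small-solution? n m a = 2 ≤? n →-dec F n ≟ F m + 13 ^ a →-dec (n , m , a) ∈? solutions

small-case-checked : ℕ → ℕ → ℕ → Bool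
small-case-checked n m a = isYes (small-solution? n m a)

all-small-cases-checked : all (λ n → all (λ m → all (small-case-checked n m) (upTo 2)) (upTo 10)) (upTo 10) ≡ true
all-small-cases-checked = refl

small-exponent-solutions : ∀ {n m a} → 2 ≤ n → m < n → a < 2 → F n ≡ F m + 13 ^ a → (n , m , a) ∈ solutions
small-exponent-solutions {n} {m} {a} 2≤n m<n a<2 eq = toWitness {a? = small-solution? n m a} decided 2≤n eq
  where
  n<10 : n < 10
  n<10 = exponent<2⇒n<10 2≤n m<n a<2 eq
  decided : T (small-case-checked n m a)
  decided = all-upTo-sound (small-case-checked n m) 2
              (all-upTo-sound (λ m → all (small-case-checked n m) (upTo 2)) 10
                (all-upTo-sound (λ n → all (λ m → all (small-case-checked n m) (upTo 2)) (upTo 10)) 10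
                  (from T-≡ all-small-cases-checked) n<10)
                (<-trans m<n n<10))
              a<2

solutions-complete : ∀ {n m} a → 2 ≤ n → m < n → F n ≡ F m + 13 ^ a → (n , m , a) ∈ solutions
solutions-complete zero 2≤n m<n = small-exponent-solutions 2≤n m<n z<s
solutions-complete (suc zero) 2≤n m<n = small-exponent-solutions 2≤n m<n (s<s z<s)
solutions-complete {n} {m} (suc (suc b)) _ _ eq = ⊥-elim (exponent≥2-impossible {n} {m} {b} eq)

theorem1p2 : (n m a : ℕ) → 2 ≤ n → m < n →
    (F n ≡ F m + 13 ^ a) ⇔
      ((n , m , a) ∈ ((2 , 0 , 0) ∷ (3 , 1 , 0) ∷ (3 , 2 , 0) ∷ (4 , 3 , 0) ∷ (7 , 0 , 1) ∷ (8 , 6 , 1) ∷ (9 , 8 , 1) ∷ []))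
theorem1p2 n m a 2≤n m<n = mk⇔ (solutions-complete a 2≤n m<n) (All.lookup solutions-correct)
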